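{- For every $n \geq 1$, the lattice $(\mathsf{Tr}(n),\preccurlyeq)$ is extremal, i.e., its number of join-irreducible elements and its number of meet-irreducible elements are both equal to the length of a longest saturated chain from its minimum to its maximum.
   Context: For $n\ge1$, $\mathsf{Tr}(n)$ is the set of words $u = u_1\cdots u_n$ over $\{0,1,2\}$ with $u_1 \neq 2$ and no indices $i<j$ with $u_i=0$, $u_j=1$, ordered componentwise ($u\preccurlyeq v$ iff $u_i\le v_i$ for all $i$); it is a lattice with minimum $0^n$ and maximum $12^{n-1}$. An element is join-irreducible (resp. meet-irreducible) if it covers (resp. is covered by) exactly one element. The length of a saturated chain $x_1 \lessdot \cdots \lessdot x_r$ is $r-1$. -}

module Defs where

open import Data.Nat using (ℕ; zero; suc)
open import Data.Fin as Fin using (Fin; toℕ)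
open import Data.Vec using (Vec; lookup; replicate; _∷_)
open import Data.Product using (Σ; ∃; _×_)
open import Data.List using (List; length)
open import Data.List.Membership.Propositional using (_∈_)
open import Data.List.Relation.Unary.Unique.Propositional using (Unique)
open import Data.Empty using (⊥)
open import Relation.Nullary using (¬_)
open import Relation.Binary.PropositionalEquality using (_≡_; _≢_)
open import Function.Bundles using (_⇔_)

Word : ℕ → Set
Word n = Vec (Fin 3) n

record Tr {n : ℕ} (u : Word n) : Set where
  field
    first≢2 : ∀ (i : Fin n) → toℕ i ≡ 0 → lookup u i ≢ Fin.suc (Fin.suc Fin.zero)
    no01    : ∀ (i j : Fin n) → i Fin.< j → lookup u i ≡ Fin.zero → lookup u j ≢ Fin.suc Fin.zero

_≼_ : ∀ {n} → Word n → Word n → Set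
u ≼ v = ∀ i → lookup u i Fin.≤ lookup v i

_≺_ : ∀ {n} → Word n → Word n → Set
u ≺ v = u ≼ v × u ≢ v

_⋖_ : ∀ {n} → Word n → Word n → Set
u ⋖ v = Tr u × Tr v × u ≺ v × (∀ w → Tr w → u ≺ w → w ≺ v → ⊥)

JoinIrr : ∀ {n} → Word n → Set
JoinIrr x = Σ _ λ y → y ⋖ x × (∀ y′ → y′ ⋖ x → y′ ≡ y)

MeetIrr : ∀ {n} → Word n → Set
MeetIrr x = Σ _ λ y → x ⋖ y × (∀ y′ → x ⋖ y′ → y′ ≡ y)

CountIs : ∀ {n} → (Word n → Set) → ℕ → Set
CountIs {n} P k = Σ (List (Word n)) λ xs →
  Unique xs × (∀ w → (w ∈ xs) ⇔ (Tr w × P w)) × length xs ≡ k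

-- Saturated chain x = x_1 ⋖ ... ⋖ x_r = z of length r - 1 = k.
data SatChain {n : ℕ} : Word n → Word n → ℕ → Set where
  single : ∀ {x} → Tr x → SatChain x x 0
  step   : ∀ {x y z k} → x ⋖ y → SatChain y z k → SatChain x z (suc k)

bot : ∀ n → Word n
bot n = replicate n Fin.zero

top : ∀ m → Word (suc m)
top m = Fin.suc Fin.zero ∷ replicate m (Fin.suc (Fin.suc Fin.zero))

LongestChainLength : ∀ {n} → Word n → Word n → ℕ → Set
LongestChainLength x z L = SatChain x z L × (∀ k → SatChain x z k → k Data.Nat.≤ L)
  where import Data.Nat

-- The weight (sum of the letters) strictly increases along ≺, so a saturated
-- chain gains at least its length in weight; 1 2^m has weight 2m + 1 and an
-- explicit chain of unit steps attains it.  The irreducibles are described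
-- explicitly: join-irreducibles 1^k 0^(n-k) and 0^k 2 0^(n-k-1),
-- meet-irreducibles 0 2^(n-1), 1 2^k 0 2^(n-k-2) and 1 2^k 1 2^(n-k-2).  Each
-- such word has a greatest element strictly below it (least strictly above),
-- hence is irreducible.  Every other word is the minimum (maximum) or the join
-- (meet) of two elements strictly below (above) it; as every strict lower bound
-- lies under a lower cover, it then has no or two lower covers.
module Submission where

open import Defs
open import Data.Nat using (ℕ; suc)
open import Data.Product using (Σ; _×_)
open import Data.Nat as ℕ using (zero; _+_; z≤n; s≤s)
open import Data.Product using (_,_; proj₁)
import Data.Nat.Properties as ℕP
open import Data.Fin as Fin using (Fin; toℕ)
import Data.Fin.Properties as FinP
open import Data.Vec using ([]; _∷_; lookup; replicate)
open import Data.Vec.Properties using (≡-dec; ∷-injectiveˡ; ∷-injectiveʳ)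
open import Data.Unit using (⊤; tt)
open import Data.Empty using (⊥; ⊥-elim)
open import Relation.Nullary using (¬_; Dec; yes; no; map′; ¬?; _×-dec_)
open import Relation.Binary.PropositionalEquality
open import Function using (_∘_)
open import Function.Bundles using (mk⇔)
open import Data.List using (List; []; _∷_; length; map)
open import Data.List.Properties using (length-map)
open import Data.List.Membership.Propositional using (_∈_)
open import Data.List.Membership.Propositional.Properties using (∈-map⁺; ∈-map⁻)
open import Data.List.Relation.Unary.Any using (here; there)
import Data.List.Relation.Unary.All as All
import Data.List.Relation.Unary.All.Properties as AllP
open import Data.List.Relation.Unary.Unique.Propositional using (Unique; []; _∷_)
import Data.List.Relation.Unary.Unique.Propositional.Properties as UniqueP

pattern O = Fin.zero
pattern I = Fin.suc Fin.zero
pattern T = Fin.suc (Fin.suc Fin.zero)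

OneFree : ∀ {n} → Word n → Set
OneFree []      = ⊤
OneFree (O ∷ r) = OneFree r
OneFree (I ∷ r) = ⊥
OneFree (T ∷ r) = OneFree r

ZeroOneFree : ∀ {n} → Word n → Set
ZeroOneFree []      = ⊤
ZeroOneFree (O ∷ r) = OneFree r
ZeroOneFree (I ∷ r) = ZeroOneFree r
ZeroOneFree (T ∷ r) = ZeroOneFree r

NotTwo : Fin 3 → Set
NotTwo O = ⊤
NotTwo I = ⊤
NotTwo T = ⊥

InTr : ∀ {n} → Word n → Set
InTr []      = ⊤
InTr (a ∷ r) = NotTwo a × ZeroOneFree (a ∷ r)

OneFree⇒ZeroOneFree : ∀ {n} (r : Word n) → OneFree r → ZeroOneFree r
OneFree⇒ZeroOneFree []      _ = tt
OneFree⇒ZeroOneFree (O ∷ r) h = h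
OneFree⇒ZeroOneFree (T ∷ r) h = OneFree⇒ZeroOneFree r h

ZeroOneFree-tail : ∀ {n} a (r : Word n) → ZeroOneFree (a ∷ r) → ZeroOneFree r
ZeroOneFree-tail O r h = OneFree⇒ZeroOneFree r h
ZeroOneFree-tail I r h = h
ZeroOneFree-tail T r h = h

OneFree⇒≢1 : ∀ {n} (r : Word n) → OneFree r → ∀ j → lookup r j ≢ I
OneFree⇒≢1 (O ∷ r) h Fin.zero     ()
OneFree⇒≢1 (O ∷ r) h (Fin.suc j) = OneFree⇒≢1 r h j
OneFree⇒≢1 (T ∷ r) h Fin.zero     ()
OneFree⇒≢1 (T ∷ r) h (Fin.suc j) = OneFree⇒≢1 r h j

≢1⇒OneFree : ∀ {n} (r : Word n) → (∀ j → lookup r j ≢ I) → OneFree r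
≢1⇒OneFree []      h = tt
≢1⇒OneFree (O ∷ r) h = ≢1⇒OneFree r (λ j → h (Fin.suc j))
≢1⇒OneFree (I ∷ r) h = h Fin.zero refl
≢1⇒OneFree (T ∷ r) h = ≢1⇒OneFree r (λ j → h (Fin.suc j))

NoZeroOnePair : ∀ {n} → Word n → Set
NoZeroOnePair {n} u = ∀ (i j : Fin n) → i Fin.< j → lookup u i ≡ O → lookup u j ≢ I

ZeroOneFree⇒NoPair : ∀ {n} (u : Word n) → ZeroOneFree u → NoZeroOnePair u
ZeroOneFree⇒NoPair (a ∷ r) h Fin.zero     Fin.zero    ()
ZeroOneFree⇒NoPair (O ∷ r) h Fin.zero     (Fin.suc j) _ _ = OneFree⇒≢1 r h j
ZeroOneFree⇒NoPair (I ∷ r) h Fin.zero     (Fin.suc j) _ ()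
ZeroOneFree⇒NoPair (T ∷ r) h Fin.zero     (Fin.suc j) _ ()
ZeroOneFree⇒NoPair (a ∷ r) h (Fin.suc i) Fin.zero    ()
ZeroOneFree⇒NoPair (a ∷ r) h (Fin.suc i) (Fin.suc j) (s≤s i<j) =
  ZeroOneFree⇒NoPair r (ZeroOneFree-tail a r h) i j i<j

NoPair⇒ZeroOneFree : ∀ {n} (u : Word n) → NoZeroOnePair u → ZeroOneFree u
NoPair⇒ZeroOneFree []      h = tt
NoPair⇒ZeroOneFree (O ∷ r) h = ≢1⇒OneFree r (λ j → h Fin.zero (Fin.suc j) (s≤s z≤n) refl)
NoPair⇒ZeroOneFree (I ∷ r) h = NoPair⇒ZeroOneFree r (λ i j i<j → h (Fin.suc i) (Fin.suc j) (s≤s i<j))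
NoPair⇒ZeroOneFree (T ∷ r) h = NoPair⇒ZeroOneFree r (λ i j i<j → h (Fin.suc i) (Fin.suc j) (s≤s i<j))

Tr⇒InTr : ∀ {n} (u : Word n) → Tr u → InTr u
Tr⇒InTr []      _ = tt
Tr⇒InTr (O ∷ r) t = tt , NoPair⇒ZeroOneFree (O ∷ r) (Tr.no01 t)
Tr⇒InTr (I ∷ r) t = tt , NoPair⇒ZeroOneFree (I ∷ r) (Tr.no01 t)
Tr⇒InTr (T ∷ r) t = ⊥-elim (Tr.first≢2 t Fin.zero refl refl)

InTr⇒Tr : ∀ {n} (u : Word n) → InTr u → Tr u
InTr⇒Tr []      _ = record { first≢2 = λ () ; no01 = λ () }
InTr⇒Tr (a ∷ r) (a≢2 , h) = record { first≢2 = first ; no01 = ZeroOneFree⇒NoPair (a ∷ r) h }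
  where
  first : ∀ i → toℕ i ≡ 0 → lookup (a ∷ r) i ≢ T
  first Fin.zero    _ a≡2 = subst NotTwo a≡2 a≢2
  first (Fin.suc i) ()

Tr-0∷ : ∀ {n} {r : Word n} → OneFree r → Tr (O ∷ r)
Tr-0∷ h = InTr⇒Tr _ (tt , h)

Tr-1∷ : ∀ {n} {r : Word n} → ZeroOneFree r → Tr (I ∷ r)
Tr-1∷ h = InTr⇒Tr _ (tt , h)

Tr⇒ZeroOneFree : ∀ {n} {u : Word n} → Tr u → ZeroOneFree u
Tr⇒ZeroOneFree {u = u} t = NoPair⇒ZeroOneFree u (Tr.no01 t)

OneFree? : ∀ {n} (r : Word n) → Dec (OneFree r)
OneFree? []      = yes tt
OneFree? (O ∷ r) = OneFree? r
OneFree? (I ∷ r) = no (λ ())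
OneFree? (T ∷ r) = OneFree? r

ZeroOneFree? : ∀ {n} (r : Word n) → Dec (ZeroOneFree r)
ZeroOneFree? []      = yes tt
ZeroOneFree? (O ∷ r) = OneFree? r
ZeroOneFree? (I ∷ r) = ZeroOneFree? r
ZeroOneFree? (T ∷ r) = ZeroOneFree? r

Tr? : ∀ {n} (u : Word n) → Dec (Tr u)
Tr? []      = yes (InTr⇒Tr [] tt)
Tr? (O ∷ r) = map′ Tr-0∷ Tr⇒ZeroOneFree (OneFree? r)
Tr? (I ∷ r) = map′ Tr-1∷ Tr⇒ZeroOneFree (ZeroOneFree? r)
Tr? (T ∷ r) = no (λ t → Tr.first≢2 t Fin.zero refl refl)

≼-∷ : ∀ {n a b} {u v : Word n} → a Fin.≤ b → u ≼ v → (a ∷ u) ≼ (b ∷ v)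
≼-∷ a≤b u≼v Fin.zero    = a≤b
≼-∷ a≤b u≼v (Fin.suc i) = u≼v i

≼-head : ∀ {n a b} {u v : Word n} → (a ∷ u) ≼ (b ∷ v) → a Fin.≤ b
≼-head h = h Fin.zero

≼-tail : ∀ {n a b} {u v : Word n} → (a ∷ u) ≼ (b ∷ v) → u ≼ v
≼-tail h i = h (Fin.suc i)

≼-refl : ∀ {n} (u : Word n) → u ≼ u
≼-refl u i = ℕP.≤-refl

≼-trans : ∀ {n} {u v w : Word n} → u ≼ v → v ≼ w → u ≼ w
≼-trans p q i = ℕP.≤-trans (p i) (q i)

≼-antisym : ∀ {n} {u v : Word n} → u ≼ v → v ≼ u → u ≡ v
≼-antisym {u = []}    {[]}    p q = refl
≼-antisym {u = a ∷ u} {b ∷ v} p q =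
  cong₂ _∷_ (FinP.toℕ-injective (ℕP.≤-antisym (≼-head p) (≼-head q)))
            (≼-antisym (≼-tail p) (≼-tail q))

_≼?_ : ∀ {n} (u v : Word n) → Dec (u ≼ v)
[]      ≼? []      = yes (λ ())
(a ∷ u) ≼? (b ∷ v) with a Fin.≤? b | u ≼? v
... | yes a≤b | yes u≼v = yes (≼-∷ a≤b u≼v)
... | no a≰b  | _       = no (λ h → a≰b (≼-head h))
... | _       | no u⋠v  = no (λ h → u⋠v (≼-tail h))

_≟_ : ∀ {n} (u v : Word n) → Dec (u ≡ v)
_≟_ = ≡-dec FinP._≟_

_≺?_ : ∀ {n} (u v : Word n) → Dec (u ≺ v)
u ≺? v = (u ≼? v) ×-dec ¬? (u ≟ v)

weight : ∀ {n} → Word n → ℕ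
weight []      = 0
weight (a ∷ r) = toℕ a + weight r

weight-mono : ∀ {n} {u v : Word n} → u ≼ v → weight u ℕ.≤ weight v
weight-mono {u = []}    {[]}    _ = z≤n
weight-mono {u = a ∷ u} {b ∷ v} h = ℕP.+-mono-≤ (≼-head h) (weight-mono {u = u} {v} (≼-tail h))

weight-strict : ∀ {n} {u v : Word n} → u ≺ v → weight u ℕ.< weight v
weight-strict {u = []}    {[]}    (_ , u≢v) = ⊥-elim (u≢v refl)
weight-strict {u = a ∷ u} {b ∷ v} (le , ne) with a FinP.≟ b
... | yes refl = ℕP.+-mono-≤-< (ℕP.≤-refl {toℕ a})
                   (weight-strict {u = u} {v} (≼-tail le , λ u≡v → ne (cong (a ∷_) u≡v)))
... | no a≢b   = ℕP.+-mono-<-≤ (ℕP.≤∧≢⇒< (≼-head le) (λ e → a≢b (FinP.toℕ-injective e)))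
                               (weight-mono {u = u} {v} (≼-tail le))

UnitStep : ∀ {n} → Word n → Word n → Set
UnitStep x y = Tr x × Tr y × x ≼ y × weight y ≡ suc (weight x)

unitStep⇒⋖ : ∀ {n} {x y : Word n} → UnitStep x y → x ⋖ y
unitStep⇒⋖ {x = x} {y} (tx , ty , x≼y , wy) = tx , ty , (x≼y , x≢y) , nothingBetween
  where
  x≢y : x ≢ y
  x≢y x≡y = ℕP.1+n≢n (sym (trans (cong weight x≡y) wy))
  nothingBetween : ∀ w → Tr w → x ≺ w → w ≺ y → ⊥
  nothingBetween w _ x≺w w≺y =
    ℕP.<⇒≱ (weight-strict x≺w) (ℕP.≤-pred (subst (suc (weight w) ℕ.≤_) wy (weight-strict w≺y)))

-- Every cover raises the weight, so a saturated chain of length k raises it by at least k.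
chain-weight : ∀ {n} {x z : Word n} {k} → SatChain x z k → k + weight x ℕ.≤ weight z
chain-weight (single _) = ℕP.≤-refl
chain-weight {x = x} {z} (step {y = y} {k = k} (_ , _ , x≺y , _) ch) = begin
  suc k + weight x   ≡⟨ ℕP.+-suc k (weight x) ⟨
  k + suc (weight x) ≤⟨ ℕP.+-monoʳ-≤ k (weight-strict x≺y) ⟩
  k + weight y       ≤⟨ chain-weight ch ⟩
  weight z           ∎
  where open ℕP.≤-Reasoning

anyWord? : ∀ {n} (P : Word n → Set) → (∀ v → Dec (P v)) → Dec (Σ (Word n) P)
anyWord? {zero} P P? with P? []
... | yes p  = yes ([] , p)
... | no ¬p = no (λ { ([] , p) → ¬p p })
anyWord? {suc n} P P?
  with anyWord? (λ v → P (O ∷ v)) (λ v → P? (O ∷ v))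
     | anyWord? (λ v → P (I ∷ v)) (λ v → P? (I ∷ v))
     | anyWord? (λ v → P (T ∷ v)) (λ v → P? (T ∷ v))
... | yes (v , p) | _           | _           = yes (O ∷ v , p)
... | no _        | yes (v , p) | _           = yes (I ∷ v , p)
... | no _        | no _        | yes (v , p) = yes (T ∷ v , p)
... | no ¬0       | no ¬1       | no ¬2       = no none
  where
  none : Σ (Word (suc n)) P → ⊥
  none (O ∷ v , p) = ¬0 (v , p)
  none (I ∷ v , p) = ¬1 (v , p)
  none (T ∷ v , p) = ¬2 (v , p)

Between : ∀ {n} → Word n → Word n → Set
Between {n} u v = Σ (Word n) λ w → Tr w × u ≺ w × w ≺ v

between? : ∀ {n} (u v : Word n) → Dec (Between u v)
between? u v = anyWord? _ (λ w → Tr? w ×-dec (u ≺? w) ×-dec (w ≺? v))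

-- Either nothing lies strictly between z and w, or we recurse on an element
-- in between, which shrinks the weight gap.
lowerCoverAbove : ∀ {n} {z w : Word n} → Tr z → Tr w → z ≺ w →
                  Σ (Word n) λ y → z ≼ y × y ⋖ w
lowerCoverAbove {n} {z} {w} tz tw z≺w = climb (weight w) tz z≺w (ℕP.m≤m+n (weight w) (weight z))
  where
  climb : ∀ gap {z} → Tr z → z ≺ w → weight w ℕ.≤ gap + weight z →
          Σ (Word n) λ y → z ≼ y × y ⋖ w
  climb zero    tz z≺w gap = ⊥-elim (ℕP.<⇒≱ (weight-strict z≺w) gap)
  climb (suc k) {z} tz z≺w gap with between? z w
  ... | no none = z , ≼-refl z , tz , tw , z≺w , λ u tu z≺u u≺w → none (u , tu , z≺u , u≺w)
  ... | yes (u , tu , z≺u , u≺w) with climb k tu u≺w gap′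
    where
    gap′ : weight w ℕ.≤ k + weight u
    gap′ = ℕP.≤-trans gap (subst (ℕ._≤ k + weight u) (ℕP.+-suc k (weight z))
                                 (ℕP.+-monoʳ-≤ k (weight-strict z≺u)))
  ... | (y , u≼y , y⋖w) = y , ≼-trans {u = z} {u} {y} (proj₁ z≺u) u≼y , y⋖w

upperCoverBelow : ∀ {n} {w z : Word n} → Tr w → Tr z → w ≺ z →
                  Σ (Word n) λ y → w ⋖ y × y ≼ z
upperCoverBelow {n} {w} {z} tw tz w≺z = descend (weight z) tz w≺z (ℕP.m≤m+n (weight z) (weight w))
  where
  descend : ∀ gap {z} → Tr z → w ≺ z → weight z ℕ.≤ gap + weight w →
            Σ (Word n) λ y → w ⋖ y × y ≼ z
  descend zero    tz w≺z gap = ⊥-elim (ℕP.<⇒≱ (weight-strict w≺z) gap)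
  descend (suc k) {z} tz w≺z gap with between? w z
  ... | no none = z , (tw , tz , w≺z , λ u tu w≺u u≺z → none (u , tu , w≺u , u≺z)) , ≼-refl z
  ... | yes (u , tu , w≺u , u≺z) with descend k tu w≺u (ℕP.≤-pred (ℕP.≤-trans (weight-strict u≺z) gap))
  ... | (y , w⋖y , y≼u) = y , w⋖y , ≼-trans {u = y} {u} {z} y≼u (proj₁ u≺z)

greatestBelow⇒JoinIrr : ∀ {n} {x y : Word n} → Tr x → Tr y → y ≺ x →
                        (∀ z → Tr z → z ≺ x → z ≼ y) → JoinIrr x
greatestBelow⇒JoinIrr {x = x} {y} tx ty y≺x greatest = y , (ty , tx , y≺x , cover) , unique
  where
  cover : ∀ w → Tr w → y ≺ w → w ≺ x → ⊥
  cover w tw (y≼w , y≢w) w≺x = y≢w (≼-antisym y≼w (greatest w tw w≺x))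
  unique : ∀ y′ → y′ ⋖ x → y′ ≡ y
  unique y′ (ty′ , _ , y′≺x , noneBetween) with y′ ≟ y
  ... | yes y′≡y = y′≡y
  ... | no y′≢y  = ⊥-elim (noneBetween y ty (greatest y′ ty′ y′≺x , y′≢y) y≺x)

leastAbove⇒MeetIrr : ∀ {n} {x y : Word n} → Tr x → Tr y → x ≺ y →
                     (∀ z → Tr z → x ≺ z → y ≼ z) → MeetIrr x
leastAbove⇒MeetIrr {x = x} {y} tx ty x≺y least = y , (tx , ty , x≺y , cover) , unique
  where
  cover : ∀ w → Tr w → x ≺ w → w ≺ y → ⊥
  cover w tw x≺w (w≼y , w≢y) = w≢y (≼-antisym w≼y (least w tw x≺w))
  unique : ∀ y′ → x ⋖ y′ → y′ ≡ y
  unique y′ (_ , ty′ , x≺y′ , noneBetween) with y ≟ y′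
  ... | yes y≡y′ = sym y≡y′
  ... | no y≢y′  = ⊥-elim (noneBetween y ty x≺y (least y′ ty′ x≺y′ , y≢y′))

-- A word that is the join of two elements of Tr strictly below it is not
-- join-irreducible: its unique lower cover would lie above both of them.
join⇒¬JoinIrr : ∀ {n} {w z₁ z₂ : Word n} → Tr w → Tr z₁ → Tr z₂ → z₁ ≺ w → z₂ ≺ w →
                (∀ y → z₁ ≼ y → z₂ ≼ y → w ≼ y) → ¬ JoinIrr w
join⇒¬JoinIrr {z₁ = z₁} {z₂} tw t₁ t₂ z₁≺w z₂≺w isJoin (y , (_ , _ , (y≼w , y≢w) , _) , unique)
  with lowerCoverAbove t₁ tw z₁≺w | lowerCoverAbove t₂ tw z₂≺w
... | (y₁ , z₁≼y₁ , y₁⋖w) | (y₂ , z₂≼y₂ , y₂⋖w) =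
  y≢w (≼-antisym y≼w (isJoin y (subst (z₁ ≼_) (unique y₁ y₁⋖w) z₁≼y₁)
                               (subst (z₂ ≼_) (unique y₂ y₂⋖w) z₂≼y₂)))

meet⇒¬MeetIrr : ∀ {n} {w z₁ z₂ : Word n} → Tr w → Tr z₁ → Tr z₂ → w ≺ z₁ → w ≺ z₂ →
                (∀ y → y ≼ z₁ → y ≼ z₂ → y ≼ w) → ¬ MeetIrr w
meet⇒¬MeetIrr {z₁ = z₁} {z₂} tw t₁ t₂ w≺z₁ w≺z₂ isMeet (y , (_ , _ , (w≼y , w≢y) , _) , unique)
  with upperCoverBelow tw t₁ w≺z₁ | upperCoverBelow tw t₂ w≺z₂
... | (y₁ , w⋖y₁ , y₁≼z₁) | (y₂ , w⋖y₂ , y₂≼z₂) =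
  w≢y (≼-antisym w≼y (isMeet y (subst (_≼ z₁) (unique y₁ w⋖y₁) y₁≼z₁)
                               (subst (_≼ z₂) (unique y₂ w⋖y₂) y₂≼z₂)))

minimal⇒¬JoinIrr : ∀ {n} {w : Word n} → (∀ y → y ≼ w → w ≼ y) → ¬ JoinIrr w
minimal⇒¬JoinIrr minimal (y , (_ , _ , (y≼w , y≢w) , _) , _) = y≢w (≼-antisym y≼w (minimal y y≼w))

maximal⇒¬MeetIrr : ∀ {n} {w : Word n} → (∀ y → Tr y → w ≼ y → y ≼ w) → ¬ MeetIrr w
maximal⇒¬MeetIrr maximal (y , (_ , ty , (w≼y , w≢y) , _) , _) = w≢y (≼-antisym w≼y (maximal y ty w≼y))

twos : ∀ m → Word m
twos m = replicate m T

bot≼ : ∀ {m} (u : Word m) → bot m ≼ u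
bot≼ []      ()
bot≼ (a ∷ u) = ≼-∷ z≤n (bot≼ u)

≼bot⇒≡ : ∀ {m} (u : Word m) → u ≼ bot m → u ≡ bot m
≼bot⇒≡ []      _ = refl
≼bot⇒≡ (O ∷ u) h = cong (O ∷_) (≼bot⇒≡ u (≼-tail h))
≼bot⇒≡ (I ∷ u) h with ≼-head h
... | ()
≼bot⇒≡ (T ∷ u) h with ≼-head h
... | ()

≼twos : ∀ {m} (u : Word m) → u ≼ twos m
≼twos []      ()
≼twos (O ∷ u) = ≼-∷ z≤n (≼twos u)
≼twos (I ∷ u) = ≼-∷ (s≤s z≤n) (≼twos u)
≼twos (T ∷ u) = ≼-∷ (s≤s (s≤s z≤n)) (≼twos u)

twos≼⇒≡ : ∀ {m} (u : Word m) → twos m ≼ u → u ≡ twos m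
twos≼⇒≡ []      _ = refl
twos≼⇒≡ (T ∷ u) h = cong (T ∷_) (twos≼⇒≡ u (≼-tail h))
twos≼⇒≡ (O ∷ u) h with ≼-head h
... | ()
twos≼⇒≡ (I ∷ u) h with ≼-head h
... | s≤s ()

OneFree-bot : ∀ m → OneFree (bot m)
OneFree-bot zero    = tt
OneFree-bot (suc m) = OneFree-bot m

OneFree-twos : ∀ m → OneFree (twos m)
OneFree-twos zero    = tt
OneFree-twos (suc m) = OneFree-twos m

ZeroOneFree-twos : ∀ m → ZeroOneFree (twos m)
ZeroOneFree-twos m = OneFree⇒ZeroOneFree (twos m) (OneFree-twos m)

NotTwo⇒≤1 : ∀ (a : Fin 3) → NotTwo a → toℕ a ℕ.≤ 1
NotTwo⇒≤1 O _ = z≤n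
NotTwo⇒≤1 I _ = s≤s z≤n
NotTwo⇒≤1 T ()

-- The join-irreducible words: 1^k 0^(n-k) and 0^k 2 0^(n-k-1), generated by
-- repeating the first letter of 1, 1 0^(m+1) and 0 2 0^m.
data JIShape : ∀ {n} → Word n → Set where
  single-one    : JIShape (I ∷ [])
  one-bot       : ∀ {m} → JIShape (I ∷ O ∷ bot m)
  zero-two-bot  : ∀ {m} → JIShape (O ∷ T ∷ bot m)
  repeat        : ∀ {m a} {r : Word m} → JIShape (a ∷ r) → JIShape (a ∷ a ∷ r)

InTr-cons : ∀ {k} {a b : Fin 3} {y : Word k} → NotTwo a → b Fin.≤ a → InTr (b ∷ y) → InTr (a ∷ b ∷ y)
InTr-cons {a = O} {O} _ _ (_ , h) = tt , h
InTr-cons {a = I} {O} _ _ (_ , h) = tt , h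
InTr-cons {a = I} {I} _ _ (_ , h) = tt , h
InTr-cons {a = I} {T} _ (s≤s ()) _
InTr-cons {a = T} () _ _

InTr-tail : ∀ {k} {a c d : Fin 3} {s : Word k} → NotTwo a → d Fin.≤ a → InTr (c ∷ d ∷ s) → InTr (d ∷ s)
InTr-tail {c = c} {O} {s} _ _ (_ , h) = tt , ZeroOneFree-tail c (O ∷ s) h
InTr-tail {c = c} {I} {s} _ _ (_ , h) = tt , ZeroOneFree-tail c (I ∷ s) h
InTr-tail {a = O} {d = T} _ () _
InTr-tail {a = I} {d = T} _ (s≤s ()) _
InTr-tail {a = T} {d = T} () _ _

InTr⇒head≡ : ∀ {k} {a c : Fin 3} {r : Word k} → NotTwo a → c Fin.≤ a → InTr (c ∷ a ∷ r) → c ≡ a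
InTr⇒head≡ {a = O} {O} _ _      _       = refl
InTr⇒head≡ {a = I} {O} _ _      (_ , ())
InTr⇒head≡ {a = I} {I} _ _      _       = refl
InTr⇒head≡ {a = O} {I} _ ()     _
InTr⇒head≡ {c = T}     _ _      (() , _)
InTr⇒head≡ {a = T}     () _     _

JIShape⇒InTr : ∀ {n} {w : Word n} → JIShape w → InTr w
JIShape⇒InTr single-one          = tt , tt
JIShape⇒InTr (one-bot {m})       = tt , OneFree-bot m
JIShape⇒InTr (zero-two-bot {m})  = tt , OneFree-bot m
JIShape⇒InTr (repeat p) with JIShape⇒InTr p
... | tp@(a≢2 , _) = InTr-cons a≢2 ℕP.≤-refl tp

-- Every join-irreducible shape has a greatest element of Tr strictly below it:
-- 0 below 1, 0^(m+2) below 1 0^(m+1) and 0 2 0^m, and a b y below a a r when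
-- b y is the one below a r.
greatestBelow : ∀ {n} {w : Word n} → JIShape w →
  Σ (Word n) λ y → InTr y × y ≺ w × (∀ z → InTr z → z ≺ w → z ≼ y)
greatestBelow single-one = O ∷ [] , (tt , tt) , (≼-∷ z≤n (λ ()) , λ ()) , greatest
  where
  greatest : ∀ z → InTr z → z ≺ (I ∷ []) → z ≼ (O ∷ [])
  greatest (O ∷ []) _ _        = ≼-refl (O ∷ [])
  greatest (I ∷ []) _ (_ , ne) = ⊥-elim (ne refl)
  greatest (T ∷ []) (() , _) _
greatestBelow (one-bot {m}) =
  bot (2 + m) , (tt , OneFree-bot m) , (≼-∷ z≤n (≼-refl (bot (suc m))) , λ ()) , greatest
  where
  greatest : ∀ z → InTr z → z ≺ (I ∷ O ∷ bot m) → z ≼ bot (2 + m)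
  greatest (O ∷ O ∷ s) _ (le , _)  = ≼-∷ z≤n (≼-∷ z≤n (≼-tail (≼-tail le)))
  greatest (I ∷ O ∷ s) _ (le , ne) = ⊥-elim (ne (cong (λ q → I ∷ O ∷ q) (≼bot⇒≡ s (≼-tail (≼-tail le)))))
  greatest (c ∷ I ∷ s) _ (le , _) with ≼-head (≼-tail le)
  ... | ()
  greatest (c ∷ T ∷ s) _ (le , _) with ≼-head (≼-tail le)
  ... | ()
  greatest (T ∷ d ∷ s) (() , _) _
greatestBelow (zero-two-bot {m}) =
  bot (2 + m) , (tt , OneFree-bot m) , (≼-∷ z≤n (≼-∷ z≤n (≼-refl (bot m))) , λ ()) , greatest
  where
  greatest : ∀ z → InTr z → z ≺ (O ∷ T ∷ bot m) → z ≼ bot (2 + m)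
  greatest (O ∷ O ∷ s) _ (le , _)  = ≼-∷ z≤n (≼-∷ z≤n (≼-tail (≼-tail le)))
  greatest (O ∷ I ∷ s) (_ , ()) _
  greatest (O ∷ T ∷ s) _ (le , ne) = ⊥-elim (ne (cong (λ q → O ∷ T ∷ q) (≼bot⇒≡ s (≼-tail (≼-tail le)))))
  greatest (I ∷ d ∷ s) _ (le , _) with ≼-head le
  ... | ()
  greatest (T ∷ d ∷ s) _ (le , _) with ≼-head le
  ... | ()
greatestBelow (repeat {a = a} {r} p) with greatestBelow p | JIShape⇒InTr p
... | (b ∷ y , ty , (y≼ar , y≢ar) , greatest) | (a≢2 , _) =
  a ∷ b ∷ y , InTr-cons a≢2 (≼-head y≼ar) ty ,
  (≼-∷ ℕP.≤-refl y≼ar , λ e → y≢ar (∷-injectiveʳ e)) , greatest′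
  where
  greatest′ : ∀ z → InTr z → z ≺ (a ∷ a ∷ r) → z ≼ (a ∷ b ∷ y)
  greatest′ (c ∷ d ∷ s) tz (z≼ , z≢) with (d ∷ s) ≟ (a ∷ r)
  ... | no ds≢ar = ≼-∷ (≼-head z≼)
                       (greatest (d ∷ s) (InTr-tail a≢2 (≼-head (≼-tail z≼)) tz) (≼-tail z≼ , ds≢ar))
  ... | yes refl = ⊥-elim (z≢ (cong (λ c → c ∷ a ∷ r) (InTr⇒head≡ a≢2 (≼-head z≼) tz)))

shape⇒JoinIrr : ∀ {n} {w : Word n} → JIShape w → Tr w × JoinIrr w
shape⇒JoinIrr {w = w} p with greatestBelow p
... | (y , ty , y≺w , greatest) =
  tw , greatestBelow⇒JoinIrr tw (InTr⇒Tr y ty) y≺w (λ z tz → greatest z (Tr⇒InTr z tz))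
  where tw = InTr⇒Tr w (JIShape⇒InTr p)

-- Completeness: every join-irreducible word of Tr has a join-irreducible
-- shape.  The case analysis is on the first letter and the number of 2s.
twoCount : ∀ {n} → Word n → ℕ
twoCount []      = 0
twoCount (O ∷ r) = twoCount r
twoCount (I ∷ r) = twoCount r
twoCount (T ∷ r) = suc (twoCount r)

twoCount-bot : ∀ m → twoCount (bot m) ≡ 0
twoCount-bot zero    = refl
twoCount-bot (suc m) = twoCount-bot m

noTwos⇒bot : ∀ {n} (t : Word n) → OneFree t → twoCount t ≡ 0 → t ≡ bot n
noTwos⇒bot []      _ _ = refl
noTwos⇒bot (O ∷ r) h e = cong (O ∷_) (noTwos⇒bot r h e)
noTwos⇒bot (T ∷ r) h ()

oneTwo⇒JIShape : ∀ {n} (t : Word n) → OneFree t → twoCount t ≡ 1 → JIShape (O ∷ t)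
oneTwo⇒JIShape (O ∷ r) h e = repeat (oneTwo⇒JIShape r h e)
oneTwo⇒JIShape (T ∷ r) h e rewrite noTwos⇒bot r h (ℕP.suc-injective e) = zero-two-bot

noTwos⇒JIShape : ∀ {n} (t : Word n) → ZeroOneFree t → twoCount t ≡ 0 → JIShape (I ∷ t)
noTwos⇒JIShape []      _ _ = single-one
noTwos⇒JIShape (O ∷ r) h e rewrite noTwos⇒bot r h e = one-bot
noTwos⇒JIShape (I ∷ r) h e = repeat (noTwos⇒JIShape r h e)
noTwos⇒JIShape (T ∷ r) h ()

-- A 1-free word t with two or more 2s is the join of lowerFirstTwo t (its
-- first 2 lowered to 0) and lowerLaterTwos t (all 2s after the first lowered).
lowerFirstTwo : ∀ {n} → Word n → Word n
lowerFirstTwo []      = []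
lowerFirstTwo (T ∷ r) = O ∷ r
lowerFirstTwo (a ∷ r) = a ∷ lowerFirstTwo r

lowerAllTwos : ∀ {n} → Word n → Word n
lowerAllTwos []      = []
lowerAllTwos (T ∷ r) = O ∷ lowerAllTwos r
lowerAllTwos (a ∷ r) = a ∷ lowerAllTwos r

lowerLaterTwos : ∀ {n} → Word n → Word n
lowerLaterTwos []      = []
lowerLaterTwos (T ∷ r) = T ∷ lowerAllTwos r
lowerLaterTwos (a ∷ r) = a ∷ lowerLaterTwos r

lowerFirstTwo≼ : ∀ {n} (t : Word n) → lowerFirstTwo t ≼ t
lowerFirstTwo≼ []      ()
lowerFirstTwo≼ (O ∷ r) = ≼-∷ z≤n (lowerFirstTwo≼ r)
lowerFirstTwo≼ (I ∷ r) = ≼-∷ (s≤s z≤n) (lowerFirstTwo≼ r)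
lowerFirstTwo≼ (T ∷ r) = ≼-∷ z≤n (≼-refl r)

lowerAllTwos≼ : ∀ {n} (t : Word n) → lowerAllTwos t ≼ t
lowerAllTwos≼ []      ()
lowerAllTwos≼ (O ∷ r) = ≼-∷ z≤n (lowerAllTwos≼ r)
lowerAllTwos≼ (I ∷ r) = ≼-∷ (s≤s z≤n) (lowerAllTwos≼ r)
lowerAllTwos≼ (T ∷ r) = ≼-∷ z≤n (lowerAllTwos≼ r)

lowerLaterTwos≼ : ∀ {n} (t : Word n) → lowerLaterTwos t ≼ t
lowerLaterTwos≼ []      ()
lowerLaterTwos≼ (O ∷ r) = ≼-∷ z≤n (lowerLaterTwos≼ r)
lowerLaterTwos≼ (I ∷ r) = ≼-∷ (s≤s z≤n) (lowerLaterTwos≼ r)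
lowerLaterTwos≼ (T ∷ r) = ≼-∷ (s≤s (s≤s z≤n)) (lowerAllTwos≼ r)

OneFree-lowerFirstTwo : ∀ {n} (t : Word n) → OneFree t → OneFree (lowerFirstTwo t)
OneFree-lowerFirstTwo []      _ = tt
OneFree-lowerFirstTwo (O ∷ r) h = OneFree-lowerFirstTwo r h
OneFree-lowerFirstTwo (T ∷ r) h = h

OneFree-lowerAllTwos : ∀ {n} (t : Word n) → OneFree t → OneFree (lowerAllTwos t)
OneFree-lowerAllTwos []      _ = tt
OneFree-lowerAllTwos (O ∷ r) h = OneFree-lowerAllTwos r h
OneFree-lowerAllTwos (T ∷ r) h = OneFree-lowerAllTwos r h

OneFree-lowerLaterTwos : ∀ {n} (t : Word n) → OneFree t → OneFree (lowerLaterTwos t)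
OneFree-lowerLaterTwos []      _ = tt
OneFree-lowerLaterTwos (O ∷ r) h = OneFree-lowerLaterTwos r h
OneFree-lowerLaterTwos (T ∷ r) h = OneFree-lowerAllTwos r h

lowerFirstTwo≢ : ∀ {n} (t : Word n) {k} → twoCount t ≡ suc k → lowerFirstTwo t ≢ t
lowerFirstTwo≢ (O ∷ r) e q = lowerFirstTwo≢ r e (∷-injectiveʳ q)
lowerFirstTwo≢ (I ∷ r) e q = lowerFirstTwo≢ r e (∷-injectiveʳ q)
lowerFirstTwo≢ (T ∷ r) e ()

lowerAllTwos-fixed : ∀ {n} (t : Word n) → lowerAllTwos t ≡ t → twoCount t ≡ 0
lowerAllTwos-fixed []      _ = refl
lowerAllTwos-fixed (O ∷ r) q = lowerAllTwos-fixed r (∷-injectiveʳ q)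
lowerAllTwos-fixed (I ∷ r) q = lowerAllTwos-fixed r (∷-injectiveʳ q)
lowerAllTwos-fixed (T ∷ r) ()

lowerLaterTwos≢ : ∀ {n} (t : Word n) {k} → twoCount t ≡ suc (suc k) → lowerLaterTwos t ≢ t
lowerLaterTwos≢ (O ∷ r) e q = lowerLaterTwos≢ r e (∷-injectiveʳ q)
lowerLaterTwos≢ (I ∷ r) e q = lowerLaterTwos≢ r e (∷-injectiveʳ q)
lowerLaterTwos≢ (T ∷ r) e q with trans (sym (lowerAllTwos-fixed r (∷-injectiveʳ q))) (ℕP.suc-injective e)
... | ()

lowerTwos-join : ∀ {n} (t y : Word n) → lowerFirstTwo t ≼ y → lowerLaterTwos t ≼ y → t ≼ y
lowerTwos-join []      []      _ _ ()
lowerTwos-join (O ∷ r) (c ∷ y) p q = ≼-∷ z≤n (lowerTwos-join r y (≼-tail p) (≼-tail q))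
lowerTwos-join (I ∷ r) (c ∷ y) p q = ≼-∷ (≼-head p) (lowerTwos-join r y (≼-tail p) (≼-tail q))
lowerTwos-join (T ∷ r) (c ∷ y) p q = ≼-∷ (≼-head q) (≼-tail p)

-- A word t of Tr with some 2 is the join of onesPrefix t = 1^k 0^(n-k), where
-- k is the position of its first 0, and of onesToZeros t (its 1s lowered to
-- 0); in front of a leading 1 they give two elements strictly below 1 t.
onesPrefix : ∀ {n} → Word n → Word n
onesPrefix []      = []
onesPrefix (O ∷ r) = bot _
onesPrefix (a ∷ r) = I ∷ onesPrefix r

onesToZeros : ∀ {n} → Word n → Word n
onesToZeros []      = []
onesToZeros (I ∷ r) = O ∷ onesToZeros r
onesToZeros (a ∷ r) = a ∷ onesToZeros r

onesPrefix≼ : ∀ {n} (t : Word n) → onesPrefix t ≼ t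
onesPrefix≼ []      ()
onesPrefix≼ (O ∷ r) = bot≼ (O ∷ r)
onesPrefix≼ (I ∷ r) = ≼-∷ (s≤s z≤n) (onesPrefix≼ r)
onesPrefix≼ (T ∷ r) = ≼-∷ (s≤s z≤n) (onesPrefix≼ r)

onesToZeros≼ : ∀ {n} (t : Word n) → onesToZeros t ≼ t
onesToZeros≼ []      ()
onesToZeros≼ (O ∷ r) = ≼-∷ z≤n (onesToZeros≼ r)
onesToZeros≼ (I ∷ r) = ≼-∷ z≤n (onesToZeros≼ r)
onesToZeros≼ (T ∷ r) = ≼-∷ (s≤s (s≤s z≤n)) (onesToZeros≼ r)

ZeroOneFree-onesPrefix : ∀ {n} (t : Word n) → ZeroOneFree (onesPrefix t)
ZeroOneFree-onesPrefix []              = tt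
ZeroOneFree-onesPrefix {suc n} (O ∷ r) = OneFree-bot n
ZeroOneFree-onesPrefix (I ∷ r)         = ZeroOneFree-onesPrefix r
ZeroOneFree-onesPrefix (T ∷ r)         = ZeroOneFree-onesPrefix r

OneFree-onesToZeros : ∀ {n} (t : Word n) → OneFree (onesToZeros t)
OneFree-onesToZeros []      = tt
OneFree-onesToZeros (O ∷ r) = OneFree-onesToZeros r
OneFree-onesToZeros (I ∷ r) = OneFree-onesToZeros r
OneFree-onesToZeros (T ∷ r) = OneFree-onesToZeros r

onesToZeros-fixes : ∀ {n} (t : Word n) → OneFree t → onesToZeros t ≡ t
onesToZeros-fixes []      _ = refl
onesToZeros-fixes (O ∷ r) h = cong (O ∷_) (onesToZeros-fixes r h)
onesToZeros-fixes (T ∷ r) h = cong (T ∷_) (onesToZeros-fixes r h)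

onesPrefix≢ : ∀ {n} (t : Word n) {k} → twoCount t ≡ suc k → onesPrefix t ≢ t
onesPrefix≢ {suc n} (O ∷ r) e q with trans (cong twoCount (∷-injectiveʳ q)) e
... | e′ rewrite twoCount-bot n = ℕP.0≢1+n e′
onesPrefix≢ (I ∷ r) e q = onesPrefix≢ r e (∷-injectiveʳ q)
onesPrefix≢ (T ∷ r) e ()

ones-join : ∀ {n} (t y : Word n) → ZeroOneFree t → onesPrefix t ≼ y → onesToZeros t ≼ y → t ≼ y
ones-join []      []      _ _ _ ()
ones-join (O ∷ r) (c ∷ y) h p q = ≼-∷ z≤n (subst (_≼ y) (onesToZeros-fixes r h) (≼-tail q))
ones-join (I ∷ r) (c ∷ y) h p q = ≼-∷ (≼-head p) (ones-join r y h (≼-tail p) (≼-tail q))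
ones-join (T ∷ r) (c ∷ y) h p q = ≼-∷ (≼-head q) (ones-join r y h (≼-tail p) (≼-tail q))

JoinIrr⇒shape : ∀ {n} (w : Word (suc n)) → InTr w → JoinIrr w → JIShape w
JoinIrr⇒shape (T ∷ t) (() , _) _
JoinIrr⇒shape (O ∷ t) (_ , h) ji with twoCount t in e
... | zero = ⊥-elim (minimal⇒¬JoinIrr minimal ji)
  where
  minimal : ∀ y → y ≼ (O ∷ t) → (O ∷ t) ≼ y
  minimal y _ = subst (_≼ y) (cong (O ∷_) (sym (noTwos⇒bot t h e))) (bot≼ y)
... | suc zero = oneTwo⇒JIShape t h e
... | suc (suc k) = ⊥-elim (join⇒¬JoinIrr (Tr-0∷ h)
        (Tr-0∷ (OneFree-lowerFirstTwo t h)) (Tr-0∷ (OneFree-lowerLaterTwos t h))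
        (≼-∷ z≤n (lowerFirstTwo≼ t) , λ q → lowerFirstTwo≢ t e (∷-injectiveʳ q))
        (≼-∷ z≤n (lowerLaterTwos≼ t) , λ q → lowerLaterTwos≢ t e (∷-injectiveʳ q))
        (λ { (c ∷ y) p q → ≼-∷ z≤n (lowerTwos-join t y (≼-tail p) (≼-tail q)) }) ji)
JoinIrr⇒shape (I ∷ t) (_ , h) ji with twoCount t in e
... | zero = noTwos⇒JIShape t h e
... | suc k = ⊥-elim (join⇒¬JoinIrr (Tr-1∷ h)
        (Tr-1∷ (ZeroOneFree-onesPrefix t)) (Tr-0∷ {r = onesToZeros t} (OneFree-onesToZeros t))
        (≼-∷ (s≤s z≤n) (onesPrefix≼ t) , λ q → onesPrefix≢ t e (∷-injectiveʳ q))
        (≼-∷ z≤n (onesToZeros≼ t) , λ ())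
        (λ { (c ∷ y) p q → ≼-∷ (≼-head p) (ones-join t y h (≼-tail p) (≼-tail q)) }) ji)

-- The meet-irreducible words: 0 2^(n-1), 1 2^k 0 2^(n-k-2) and 1 2^k 1 2^(n-k-2),
-- generated by inserting 2s after the first letter of 0, 1 0 2^m and 1 1 2^m.
data MIShape : ∀ {n} → Word n → Set where
  single-zero   : MIShape (O ∷ [])
  one-zero-twos : ∀ {m} → MIShape (I ∷ O ∷ twos m)
  one-one-twos  : ∀ {m} → MIShape (I ∷ I ∷ twos m)
  insertTwo     : ∀ {m a} {r : Word m} → MIShape (a ∷ r) → MIShape (a ∷ T ∷ r)

InTr-insertTwo : ∀ {k} (a : Fin 3) (r : Word k) → InTr (a ∷ r) → InTr (a ∷ T ∷ r)
InTr-insertTwo O r (_ , h) = tt , h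
InTr-insertTwo I r (_ , h) = tt , h
InTr-insertTwo T r (() , _)

InTr-deleteTwo : ∀ {k} (a : Fin 3) (r : Word k) → InTr (a ∷ T ∷ r) → InTr (a ∷ r)
InTr-deleteTwo O r (_ , h) = tt , h
InTr-deleteTwo I r (_ , h) = tt , h
InTr-deleteTwo T r (() , _)

MIShape⇒InTr : ∀ {n} {w : Word n} → MIShape w → InTr w
MIShape⇒InTr single-zero                = tt , tt
MIShape⇒InTr (one-zero-twos {m})        = tt , OneFree-twos m
MIShape⇒InTr (one-one-twos {m})         = tt , ZeroOneFree-twos m
MIShape⇒InTr (insertTwo {a = a} {r} p)  = InTr-insertTwo a r (MIShape⇒InTr p)

-- Every meet-irreducible shape has a least element of Tr strictly above it:
-- 1 above 0, 1 1 2^m above 1 0 2^m, 1 2^(m+1) above 1 1 2^m, and b 2 y above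
-- a 2 r when b y is the one above a r.
leastAbove : ∀ {n} {w : Word n} → MIShape w →
  Σ (Word n) λ y → InTr y × w ≺ y × (∀ z → InTr z → w ≺ z → y ≼ z)
leastAbove single-zero = I ∷ [] , (tt , tt) , (≼-∷ z≤n (λ ()) , λ ()) , least
  where
  least : ∀ z → InTr z → (O ∷ []) ≺ z → (I ∷ []) ≼ z
  least (O ∷ []) _ (_ , ne) = ⊥-elim (ne refl)
  least (I ∷ []) _ _        = ≼-refl (I ∷ [])
  least (T ∷ []) (() , _) _
leastAbove (one-zero-twos {m}) =
  I ∷ I ∷ twos m , (tt , ZeroOneFree-twos m) ,
  (≼-∷ (s≤s z≤n) (≼-∷ z≤n (≼-refl (twos m))) , λ ()) , least
  where
  least : ∀ z → InTr z → (I ∷ O ∷ twos m) ≺ z → (I ∷ I ∷ twos m) ≼ z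
  least (O ∷ d ∷ s) _ (le , _) with ≼-head le
  ... | ()
  least (T ∷ d ∷ s) (() , _) _
  least (I ∷ O ∷ s) _ (le , ne) =
    ⊥-elim (ne (cong (λ q → I ∷ O ∷ q) (sym (twos≼⇒≡ s (≼-tail (≼-tail le))))))
  least (I ∷ I ∷ s) _ (le , _)  = ≼-∷ (s≤s z≤n) (≼-∷ (s≤s z≤n) (≼-tail (≼-tail le)))
  least (I ∷ T ∷ s) _ (le , _)  = ≼-∷ (s≤s z≤n) (≼-∷ (s≤s z≤n) (≼-tail (≼-tail le)))
leastAbove (one-one-twos {m}) =
  I ∷ T ∷ twos m , (tt , ZeroOneFree-twos m) ,
  (≼-∷ (s≤s z≤n) (≼-∷ (s≤s z≤n) (≼-refl (twos m))) , λ ()) , least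
  where
  least : ∀ z → InTr z → (I ∷ I ∷ twos m) ≺ z → (I ∷ T ∷ twos m) ≼ z
  least (O ∷ d ∷ s) _ (le , _) with ≼-head le
  ... | ()
  least (T ∷ d ∷ s) (() , _) _
  least (I ∷ O ∷ s) _ (le , _) with ≼-head (≼-tail le)
  ... | ()
  least (I ∷ I ∷ s) _ (le , ne) =
    ⊥-elim (ne (cong (λ q → I ∷ I ∷ q) (sym (twos≼⇒≡ s (≼-tail (≼-tail le))))))
  least (I ∷ T ∷ s) _ (le , _)  = ≼-∷ (s≤s z≤n) (≼-∷ (s≤s (s≤s z≤n)) (≼-tail (≼-tail le)))
leastAbove (insertTwo {a = a} {r} p) with leastAbove p
... | (b ∷ y , ty , (ar≼y , ar≢y) , least) =
  b ∷ T ∷ y , InTr-insertTwo b y ty , (≼-∷ (≼-head ar≼y) (≼-∷ ℕP.≤-refl (≼-tail ar≼y)) , a2r≢b2y) , least′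
  where
  a2r≢b2y : a ∷ T ∷ r ≢ b ∷ T ∷ y
  a2r≢b2y e = ar≢y (cong₂ _∷_ (∷-injectiveˡ e) (∷-injectiveʳ (∷-injectiveʳ e)))
  least′ : ∀ z → InTr z → (a ∷ T ∷ r) ≺ z → (b ∷ T ∷ y) ≼ z
  least′ (c ∷ O ∷ s) _ (le , _) with ≼-head (≼-tail le)
  ... | ()
  least′ (c ∷ I ∷ s) _ (le , _) with ≼-head (≼-tail le)
  ... | s≤s ()
  least′ (c ∷ T ∷ s) tz (le , ne) = ≼-∷ (≼-head by≼cs) (≼-∷ ℕP.≤-refl (≼-tail by≼cs))
    where
    ar≢cs : a ∷ r ≢ c ∷ s
    ar≢cs e = ne (cong₂ _∷_ (∷-injectiveˡ e) (cong (T ∷_) (∷-injectiveʳ e)))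
    by≼cs : (b ∷ y) ≼ (c ∷ s)
    by≼cs = least (c ∷ s) (InTr-deleteTwo c s tz) (≼-∷ (≼-head le) (≼-tail (≼-tail le)) , ar≢cs)

shape⇒MeetIrr : ∀ {n} {w : Word n} → MIShape w → Tr w × MeetIrr w
shape⇒MeetIrr {w = w} p with leastAbove p
... | (y , ty , w≺y , least) =
  tw , leastAbove⇒MeetIrr tw (InTr⇒Tr y ty) w≺y (λ z tz → least z (Tr⇒InTr z tz))
  where tw = InTr⇒Tr w (MIShape⇒InTr p)

-- Completeness, by case analysis on the first letter and the number of
-- letters other than 2.
nonTwoCount : ∀ {n} → Word n → ℕ
nonTwoCount []      = 0
nonTwoCount (T ∷ r) = nonTwoCount r
nonTwoCount (a ∷ r) = suc (nonTwoCount r)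

nonTwoCount-twos : ∀ m → nonTwoCount (twos m) ≡ 0
nonTwoCount-twos zero    = refl
nonTwoCount-twos (suc m) = nonTwoCount-twos m

onlyTwos⇒twos : ∀ {n} (t : Word n) → nonTwoCount t ≡ 0 → t ≡ twos n
onlyTwos⇒twos []      _ = refl
onlyTwos⇒twos (T ∷ r) e = cong (T ∷_) (onlyTwos⇒twos r e)

onlyTwos⇒MIShape : ∀ {n} (t : Word n) → nonTwoCount t ≡ 0 → MIShape (O ∷ t)
onlyTwos⇒MIShape []      _ = single-zero
onlyTwos⇒MIShape (T ∷ r) e = insertTwo (onlyTwos⇒MIShape r e)

oneNonTwo⇒MIShape : ∀ {n} (t : Word n) → nonTwoCount t ≡ 1 → MIShape (I ∷ t)
oneNonTwo⇒MIShape (T ∷ r) e = insertTwo (oneNonTwo⇒MIShape r e)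
oneNonTwo⇒MIShape (O ∷ r) e rewrite onlyTwos⇒twos r (ℕP.suc-injective e) = one-zero-twos
oneNonTwo⇒MIShape (I ∷ r) e rewrite onlyTwos⇒twos r (ℕP.suc-injective e) = one-one-twos

-- A word t with two or more letters other than 2 is the meet of raiseFirst t
-- (its first non-2 letter raised to 2) and raiseLater t (all later letters
-- raised to 2).
raiseFirst : ∀ {n} → Word n → Word n
raiseFirst []      = []
raiseFirst (T ∷ r) = T ∷ raiseFirst r
raiseFirst (a ∷ r) = T ∷ r

raiseLater : ∀ {n} → Word n → Word n
raiseLater []      = []
raiseLater (T ∷ r) = T ∷ raiseLater r
raiseLater (a ∷ r) = a ∷ twos _

raiseFirst≽ : ∀ {n} (t : Word n) → t ≼ raiseFirst t
raiseFirst≽ []      ()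
raiseFirst≽ (T ∷ r) = ≼-∷ ℕP.≤-refl (raiseFirst≽ r)
raiseFirst≽ (O ∷ r) = ≼-∷ z≤n (≼-refl r)
raiseFirst≽ (I ∷ r) = ≼-∷ (s≤s z≤n) (≼-refl r)

raiseLater≽ : ∀ {n} (t : Word n) → t ≼ raiseLater t
raiseLater≽ []      ()
raiseLater≽ (T ∷ r) = ≼-∷ ℕP.≤-refl (raiseLater≽ r)
raiseLater≽ (O ∷ r) = ≼-∷ z≤n (≼twos r)
raiseLater≽ (I ∷ r) = ≼-∷ ℕP.≤-refl (≼twos r)

ZeroOneFree-raiseFirst : ∀ {n} (t : Word n) → ZeroOneFree t → ZeroOneFree (raiseFirst t)
ZeroOneFree-raiseFirst []      _ = tt
ZeroOneFree-raiseFirst (T ∷ r) h = ZeroOneFree-raiseFirst r h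
ZeroOneFree-raiseFirst (O ∷ r) h = ZeroOneFree-tail O r h
ZeroOneFree-raiseFirst (I ∷ r) h = h

ZeroOneFree-raiseLater : ∀ {n} (t : Word n) → ZeroOneFree t → ZeroOneFree (raiseLater t)
ZeroOneFree-raiseLater []              _ = tt
ZeroOneFree-raiseLater (T ∷ r)         h = ZeroOneFree-raiseLater r h
ZeroOneFree-raiseLater {suc n} (O ∷ r) _ = OneFree-twos n
ZeroOneFree-raiseLater {suc n} (I ∷ r) _ = ZeroOneFree-twos n

raiseFirst≢ : ∀ {n} (t : Word n) {k} → nonTwoCount t ≡ suc k → raiseFirst t ≢ t
raiseFirst≢ (T ∷ r) e q = raiseFirst≢ r e (∷-injectiveʳ q)
raiseFirst≢ (O ∷ r) e ()
raiseFirst≢ (I ∷ r) e ()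

twos≢ : ∀ {m} (r : Word m) {k} → nonTwoCount r ≡ suc k → twos m ≢ r
twos≢ {m} r e q = ℕP.0≢1+n (trans (sym (nonTwoCount-twos m)) (trans (cong nonTwoCount q) e))

raiseLater≢ : ∀ {n} (t : Word n) {k} → nonTwoCount t ≡ suc (suc k) → raiseLater t ≢ t
raiseLater≢ (T ∷ r) e q = raiseLater≢ r e (∷-injectiveʳ q)
raiseLater≢ (O ∷ r) e q = twos≢ r (ℕP.suc-injective e) (∷-injectiveʳ q)
raiseLater≢ (I ∷ r) e q = twos≢ r (ℕP.suc-injective e) (∷-injectiveʳ q)

raise-meet : ∀ {n} (t y : Word n) → y ≼ raiseFirst t → y ≼ raiseLater t → y ≼ t
raise-meet []      []      _ _ ()
raise-meet (T ∷ r) (c ∷ y) p q = ≼-∷ (≼-head p) (raise-meet r y (≼-tail p) (≼-tail q))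
raise-meet (O ∷ r) (c ∷ y) p q = ≼-∷ (≼-head q) (≼-tail p)
raise-meet (I ∷ r) (c ∷ y) p q = ≼-∷ (≼-head q) (≼-tail p)

MeetIrr⇒shape : ∀ {n} (w : Word (suc n)) → InTr w → MeetIrr w → MIShape w
MeetIrr⇒shape (T ∷ t) (() , _) _
MeetIrr⇒shape {n} (O ∷ t) (_ , h) mi with nonTwoCount t in e
... | zero  = onlyTwos⇒MIShape t e
... | suc k = ⊥-elim (meet⇒¬MeetIrr (Tr-0∷ h)
        (Tr-1∷ {r = t} (OneFree⇒ZeroOneFree t h)) (Tr-0∷ {r = twos n} (OneFree-twos n))
        (≼-∷ z≤n (≼-refl t) , λ ())
        (≼-∷ z≤n (≼twos t) , λ q → twos≢ t e (sym (∷-injectiveʳ q)))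
        (λ { (c ∷ y) p q → ≼-∷ (≼-head q) (≼-tail p) }) mi)
MeetIrr⇒shape {n} (I ∷ t) (_ , h) mi with nonTwoCount t in e
... | zero = ⊥-elim (maximal⇒¬MeetIrr maximal mi)
  where
  maximal : ∀ y → Tr y → (I ∷ t) ≼ y → y ≼ (I ∷ t)
  maximal (c ∷ y) ty _ = ≼-∷ (NotTwo⇒≤1 c (proj₁ (Tr⇒InTr _ ty)))
                             (subst (y ≼_) (sym (onlyTwos⇒twos t e)) (≼twos y))
... | suc zero = oneNonTwo⇒MIShape t e
... | suc (suc k) = ⊥-elim (meet⇒¬MeetIrr (Tr-1∷ h)
        (Tr-1∷ (ZeroOneFree-raiseFirst t h)) (Tr-1∷ (ZeroOneFree-raiseLater t h))
        (≼-∷ (s≤s z≤n) (raiseFirst≽ t) , λ q → raiseFirst≢ t e (sym (∷-injectiveʳ q)))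
        (≼-∷ (s≤s z≤n) (raiseLater≽ t) , λ q → raiseLater≢ t e (sym (∷-injectiveʳ q)))
        (λ { (c ∷ y) p q → ≼-∷ (≼-head p) (raise-meet t y (≼-tail p) (≼-tail q)) }) mi)

countByShapes : ∀ {n} {P S : Word n → Set} (xs : List (Word n)) → Unique xs →
                (∀ {w} → w ∈ xs → S w) → (∀ {w} → S w → w ∈ xs) →
                (∀ {w} → S w → Tr w × P w) → (∀ {w} → Tr w → P w → S w) →
                CountIs P (length xs)
countByShapes xs unique listed complete sound characterised =
  xs , unique , (λ w → mk⇔ (sound ∘ listed) (λ (tw , pw) → complete (characterised tw pw))) , refl

unique-cons₂ : ∀ {A B : Set} {x y : B} {f : A → B} {xs : List A} → x ≢ y →
               (∀ v → x ≢ f v) → (∀ v → y ≢ f v) → (∀ {u v} → f u ≡ f v → u ≡ v) →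
               Unique xs → Unique (x ∷ y ∷ map f xs)
unique-cons₂ {xs = xs} x≢y x∉ y∉ f-inj unique =
  (x≢y All.∷ AllP.map⁺ (All.universal x∉ xs)) ∷ AllP.map⁺ (All.universal y∉ xs) ∷
  UniqueP.map⁺ f-inj unique

repeatHead : ∀ {m} → Word (suc m) → Word (2 + m)
repeatHead (a ∷ r) = a ∷ a ∷ r

repeatHead-injective : ∀ {m} {u v : Word (suc m)} → repeatHead u ≡ repeatHead v → u ≡ v
repeatHead-injective {u = a ∷ r} {b ∷ s} e = ∷-injectiveʳ e

joinIrreducibles : ∀ m → List (Word (suc m))
joinIrreducibles zero    = (I ∷ []) ∷ []
joinIrreducibles (suc m) =
  (I ∷ O ∷ bot m) ∷ (O ∷ T ∷ bot m) ∷ map repeatHead (joinIrreducibles m)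

joinIrreducibles-listed : ∀ m {w} → w ∈ joinIrreducibles m → JIShape w
joinIrreducibles-listed zero    (here refl)         = single-one
joinIrreducibles-listed (suc m) (here refl)         = one-bot
joinIrreducibles-listed (suc m) (there (here refl)) = zero-two-bot
joinIrreducibles-listed (suc m) (there (there w∈)) with ∈-map⁻ repeatHead w∈
... | (a ∷ r , v∈ , refl) = repeat (joinIrreducibles-listed m v∈)

joinIrreducibles-complete : ∀ m {w} → JIShape w → w ∈ joinIrreducibles m
joinIrreducibles-complete zero    single-one   = here refl
joinIrreducibles-complete (suc m) one-bot      = here refl
joinIrreducibles-complete (suc m) zero-two-bot = there (here refl)
joinIrreducibles-complete (suc m) (repeat {a = a} {r} p) =
  there (there (∈-map⁺ repeatHead (joinIrreducibles-complete m {a ∷ r} p)))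

joinIrreducibles-unique : ∀ m → Unique (joinIrreducibles m)
joinIrreducibles-unique zero    = All.[] ∷ []
joinIrreducibles-unique (suc m) =
  unique-cons₂ (λ ()) 1-0≢ 0-2≢ repeatHead-injective (joinIrreducibles-unique m)
  where
  1-0≢ : ∀ v → (I ∷ O ∷ bot m) ≢ repeatHead v
  1-0≢ (O ∷ r) ()
  1-0≢ (I ∷ r) ()
  1-0≢ (T ∷ r) ()
  0-2≢ : ∀ v → (O ∷ T ∷ bot m) ≢ repeatHead v
  0-2≢ (O ∷ r) ()
  0-2≢ (I ∷ r) ()
  0-2≢ (T ∷ r) ()

-- Both enumerations grow by two at each step, from length 1.
length-step : ∀ {A B : Set} (f : A → B) (xs : List A) {m} → length xs ≡ suc (m + m) →
              2 + length (map f xs) ≡ suc (suc m + suc m)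
length-step f xs {m} len = begin
  2 + length (map f xs)  ≡⟨ cong (2 +_) (trans (length-map f xs) len) ⟩
  3 + (m + m)            ≡⟨ cong (2 +_) (ℕP.+-suc m m) ⟨
  suc (suc m + suc m)    ∎
  where open ≡-Reasoning

joinIrreducibles-length : ∀ m → length (joinIrreducibles m) ≡ suc (m + m)
joinIrreducibles-length zero    = refl
joinIrreducibles-length (suc m) = length-step repeatHead (joinIrreducibles m) (joinIrreducibles-length m)

countJoinIrr : ∀ m → CountIs {suc m} JoinIrr (suc (m + m))
countJoinIrr m = subst (CountIs JoinIrr) (joinIrreducibles-length m)
  (countByShapes (joinIrreducibles m) (joinIrreducibles-unique m)
    (joinIrreducibles-listed m) (joinIrreducibles-complete m) shape⇒JoinIrr
    (λ {w} tw ji → JoinIrr⇒shape w (Tr⇒InTr w tw) ji))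

insertTwoAfterHead : ∀ {m} → Word (suc m) → Word (2 + m)
insertTwoAfterHead (a ∷ r) = a ∷ T ∷ r

insertTwoAfterHead-injective : ∀ {m} {u v : Word (suc m)} →
                               insertTwoAfterHead u ≡ insertTwoAfterHead v → u ≡ v
insertTwoAfterHead-injective {u = a ∷ r} {b ∷ s} e =
  cong₂ _∷_ (∷-injectiveˡ e) (∷-injectiveʳ (∷-injectiveʳ e))

meetIrreducibles : ∀ m → List (Word (suc m))
meetIrreducibles zero    = (O ∷ []) ∷ []
meetIrreducibles (suc m) =
  (I ∷ O ∷ twos m) ∷ (I ∷ I ∷ twos m) ∷ map insertTwoAfterHead (meetIrreducibles m)

meetIrreducibles-listed : ∀ m {w} → w ∈ meetIrreducibles m → MIShape w
meetIrreducibles-listed zero    (here refl)         = single-zero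
meetIrreducibles-listed (suc m) (here refl)         = one-zero-twos
meetIrreducibles-listed (suc m) (there (here refl)) = one-one-twos
meetIrreducibles-listed (suc m) (there (there w∈)) with ∈-map⁻ insertTwoAfterHead w∈
... | (a ∷ r , v∈ , refl) = insertTwo (meetIrreducibles-listed m v∈)

meetIrreducibles-complete : ∀ m {w} → MIShape w → w ∈ meetIrreducibles m
meetIrreducibles-complete zero    single-zero   = here refl
meetIrreducibles-complete (suc m) one-zero-twos = here refl
meetIrreducibles-complete (suc m) one-one-twos  = there (here refl)
meetIrreducibles-complete (suc m) (insertTwo {a = a} {r} p) =
  there (there (∈-map⁺ insertTwoAfterHead (meetIrreducibles-complete m {a ∷ r} p)))

meetIrreducibles-unique : ∀ m → Unique (meetIrreducibles m)
meetIrreducibles-unique zero    = All.[] ∷ []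
meetIrreducibles-unique (suc m) =
  unique-cons₂ (λ ()) 1-0≢ 1-1≢ insertTwoAfterHead-injective (meetIrreducibles-unique m)
  where
  1-0≢ : ∀ v → (I ∷ O ∷ twos m) ≢ insertTwoAfterHead v
  1-0≢ (a ∷ r) ()
  1-1≢ : ∀ v → (I ∷ I ∷ twos m) ≢ insertTwoAfterHead v
  1-1≢ (a ∷ r) ()

meetIrreducibles-length : ∀ m → length (meetIrreducibles m) ≡ suc (m + m)
meetIrreducibles-length zero    = refl
meetIrreducibles-length (suc m) =
  length-step insertTwoAfterHead (meetIrreducibles m) (meetIrreducibles-length m)

countMeetIrr : ∀ m → CountIs {suc m} MeetIrr (suc (m + m))
countMeetIrr m = subst (CountIs MeetIrr) (meetIrreducibles-length m)
  (countByShapes (meetIrreducibles m) (meetIrreducibles-unique m)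
    (meetIrreducibles-listed m) (meetIrreducibles-complete m) shape⇒MeetIrr
    (λ {w} tw mi → MeetIrr⇒shape w (Tr⇒InTr w tw) mi))

data UnitChain {n : ℕ} : Word n → Word n → ℕ → Set where
  stay : ∀ {x} → Tr x → UnitChain x x 0
  up   : ∀ {x y z k} → UnitStep x y → UnitChain y z k → UnitChain x z (suc k)

UnitChain⇒SatChain : ∀ {n} {x z : Word n} {k} → UnitChain x z k → SatChain x z k
UnitChain⇒SatChain (stay t) = single t
UnitChain⇒SatChain (up s c) = step (unitStep⇒⋖ s) (UnitChain⇒SatChain c)

_++ᶜ_ : ∀ {n} {x y z : Word n} {k j} → UnitChain x y k → UnitChain y z j → UnitChain x z (k + j)
stay _ ++ᶜ d = d
up s c ++ᶜ d = up s (c ++ᶜ d)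

Tr-prefix1 : ∀ {n} {x : Word n} → Tr x → Tr (I ∷ x)
Tr-prefix1 t = Tr-1∷ (Tr⇒ZeroOneFree t)

UnitChain-prefix1 : ∀ {n} {x z : Word n} {k} → UnitChain x z k → UnitChain (I ∷ x) (I ∷ z) k
UnitChain-prefix1 (stay t) = stay (Tr-prefix1 t)
UnitChain-prefix1 (up (tx , ty , x≼y , wy) c) =
  up (Tr-prefix1 tx , Tr-prefix1 ty , ≼-∷ ℕP.≤-refl x≼y , cong suc wy) (UnitChain-prefix1 c)

-- From 0^(m+1) to 1 2^m in 2m + 1 unit steps: raise the first letter to 1,
-- climb behind it from 0^m to 1 2^(m-1), and raise the second letter to 2.
staircase : ∀ m → UnitChain (bot (suc m)) (top m) (suc (m + m))
staircase zero = up (Tr-0∷ tt , Tr-1∷ tt , ≼-∷ z≤n (λ ()) , refl) (stay (Tr-1∷ tt))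
staircase (suc m) = subst (UnitChain _ _) length≡
  (up raiseHead (UnitChain-prefix1 (staircase m) ++ᶜ
                 up raiseSecond (stay (Tr-1∷ (ZeroOneFree-twos (suc m))))))
  where
  length≡ : suc (suc (m + m) + 1) ≡ suc (suc m + suc m)
  length≡ = cong (λ q → suc (suc q)) (trans (ℕP.+-comm (m + m) 1) (sym (ℕP.+-suc m m)))
  raiseHead : UnitStep (bot (2 + m)) (I ∷ bot (suc m))
  raiseHead = Tr-0∷ (OneFree-bot (suc m)) ,
              Tr-1∷ (OneFree⇒ZeroOneFree (bot (suc m)) (OneFree-bot (suc m))) ,
              ≼-∷ z≤n (≼-refl (bot (suc m))) , refl
  raiseSecond : UnitStep (I ∷ I ∷ twos m) (I ∷ T ∷ twos m)
  raiseSecond = Tr-1∷ (ZeroOneFree-twos m) , Tr-1∷ (ZeroOneFree-twos (suc m)) ,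
                ≼-∷ ℕP.≤-refl (≼-∷ (s≤s z≤n) (≼-refl (twos m))) , refl

weight-bot : ∀ m → weight (bot m) ≡ 0
weight-bot zero    = refl
weight-bot (suc m) = weight-bot m

weight-twos : ∀ m → weight (twos m) ≡ m + m
weight-twos zero    = refl
weight-twos (suc m) = cong suc (trans (cong suc (weight-twos m)) (sym (ℕP.+-suc m m)))

-- The staircase is longest: a saturated chain can gain at most the
-- weight 2m + 1 of 1 2^m.
longestChain : ∀ m → LongestChainLength (bot (suc m)) (top m) (suc (m + m))
longestChain m = UnitChain⇒SatChain (staircase m) , λ k ch → bound k (chain-weight ch)
  where
  bound : ∀ k → k + weight (bot (suc m)) ℕ.≤ weight (top m) → k ℕ.≤ suc (m + m)
  bound k h rewrite weight-bot m | weight-twos m | ℕP.+-identityʳ k = h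

proposition3p2 : ∀ (m : ℕ) → Σ ℕ λ L →
    LongestChainLength (bot (suc m)) (top m) L
      × CountIs {suc m} JoinIrr L
      × CountIs {suc m} MeetIrr L
proposition3p2 m = suc (m + m) , longestChain m , countJoinIrr m , countMeetIrr m
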